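{- Let $G$ be a connected trimmed bipartite graph and let $\pi$ be an $\mathcal{M}^+$-minimal edge of $G$. Then for every edge $e\neq\pi$ of $G$, we have $e\in b^-(G_\pi^-)$ if and only if $\mathcal{M}_\pi^+=\mathcal{M}_e^+$. Furthermore, every edge of $b^+(G_\pi^-)$ is an isolated edge of $G$ (an edge forming a connected component of $G$ by itself).
   Context: All graphs are finite bipartite graphs with at least one perfect matching. $\mathcal{M}(G)$ is the set of perfect matchings; for an edge $e$, $\mathcal{M}_e^+$ is the set of perfect matchings of $G$ containing $e$. $b^+(X)$ (resp. $b^-(X)$) is the set of edges of a graph $X$ contained in every (resp. no) perfect matching of $X$. $G_e^-$ is $G$ with the edge $e$ deleted. An edge $\pi$ is $\mathcal{M}^+$-minimal if there is no edge $e$ with $\mathcal{M}_e^+\subsetneq\mathcal{M}_\pi^+$. For a perfect matching $M$ and colour classes $V_1,V_2$, $D(G,M)$ is the digraph orienting edges of $M$ from $V_1$ to $V_2$ and other edges from $V_2$ to $V_1$; a component is strongly connected if its part of $D(G,M)$ is strongly connected. $G$ is trimmed if: it has at most one isolated edge $ab$ (equivalently $|b^+(G)|\le 1$); every component other than possibly $ab$ is strongly connected (so $b^-(G)=\emptyset$); and every vertex other than $a,b$ has degree at least $3$. -}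

module Defs where

open import Data.Nat using (ℕ; suc)
open import Data.Fin using (Fin; punchIn)
open import Data.Fin.Subset using (Subset; _∈_; _∉_)
open import Data.Sum using (_⊎_; inj₁; inj₂)
open import Data.Product using (Σ; ∃; _×_; _,_)
open import Relation.Nullary using (¬_)
open import Relation.Binary.PropositionalEquality using (_≡_; _≢_)
open import Relation.Binary.Construct.Closure.ReflexiveTransitive using (Star)

-- A finite bipartite (multi)graph with colour classes V₁ = Fin p, V₂ = Fin q
-- and edge set Fin m; edge e joins left e ∈ V₁ and right e ∈ V₂.
record BipGraph (p q m : ℕ) : Set where
  field
    left  : Fin m → Fin p
    right : Fin m → Fin q
open BipGraph public

Vertex : ℕ → ℕ → Set
Vertex p q = Fin p ⊎ Fin q

module _ {p q m : ℕ} (G : BipGraph p q m) where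

  Incident : Fin m → Vertex p q → Set
  Incident e v = (v ≡ inj₁ (left G e)) ⊎ (v ≡ inj₂ (right G e))

  IsPM : Subset m → Set
  IsPM M = ∀ (v : Vertex p q) →
             (∃ λ e → e ∈ M × Incident e v)
           × (∀ e f → e ∈ M → f ∈ M → Incident e v → Incident f v → e ≡ f)

  HasPM : Set
  HasPM = ∃ λ M → IsPM M

  InBPlus : Fin m → Set
  InBPlus e = ∀ M → IsPM M → e ∈ M

  InBMinus : Fin m → Set
  InBMinus e = ∀ M → IsPM M → e ∉ M

  MPlusSub : Fin m → Fin m → Set
  MPlusSub e f = ∀ M → IsPM M → e ∈ M → f ∈ M

  MPlusEq : Fin m → Fin m → Set
  MPlusEq e f = MPlusSub e f × MPlusSub f e

  MPlusStrictSub : Fin m → Fin m → Set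
  MPlusStrictSub e f = MPlusSub e f × (∃ λ M → IsPM M × f ∈ M × e ∉ M)

  MPlusMinimal : Fin m → Set
  MPlusMinimal π = ¬ (∃ λ e → MPlusStrictSub e π)

  Adj : Vertex p q → Vertex p q → Set
  Adj u v = ∃ λ e → Incident e u × Incident e v × u ≢ v

  Connected : Vertex p q → Vertex p q → Set
  Connected = Star Adj

  IsConnected : Set
  IsConnected = ∀ u v → Connected u v

  -- arcs of D(G,M): edges of M oriented V₁ → V₂, other edges V₂ → V₁
  Arc : Subset m → Vertex p q → Vertex p q → Set
  Arc M u v = ∃ λ e →
      (e ∈ M × u ≡ inj₁ (left G e) × v ≡ inj₂ (right G e))
    ⊎ (e ∉ M × u ≡ inj₂ (right G e) × v ≡ inj₁ (left G e))

  Reach : Subset m → Vertex p q → Vertex p q → Set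
  Reach M = Star (Arc M)

  IsolatedEdge : Fin m → Set
  IsolatedEdge e = ∀ f v → Incident e v → Incident f v → f ≡ e

  OnIsolatedEdge : Vertex p q → Set
  OnIsolatedEdge v = ∃ λ e → IsolatedEdge e × Incident e v

  Deg≥3 : Vertex p q → Set
  Deg≥3 v = ∃ λ e₁ → ∃ λ e₂ → ∃ λ e₃ →
    Incident e₁ v × Incident e₂ v × Incident e₃ v
    × e₁ ≢ e₂ × e₁ ≢ e₃ × e₂ ≢ e₃

  record Trimmed : Set where
    field
      atMostOneIsolated : ∀ e f → IsolatedEdge e → IsolatedEdge f → e ≡ f
      -- every component other than the isolated edge is strongly connected in D(G,M)
      stronglyConnected : ∀ M → IsPM M → ∀ u v →
        ¬ OnIsolatedEdge u → Connected u v → Reach M u v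
      degree : ∀ v → ¬ OnIsolatedEdge v → Deg≥3 v

-- G⁻_π : delete edge π; the edges of G⁻_π are Fin k, edge e' of G⁻_π is edge punchIn π e' of G
delete : ∀ {p q k} → BipGraph p q (suc k) → Fin (suc k) → BipGraph p q k
delete G π = record { left = λ e → left G (punchIn π e) ; right = λ e → right G (punchIn π e) }

{-# OPTIONS --safe #-}
-- Perfect matchings of G − π are exactly the perfect matchings of G avoiding π. So e ∈ b⁻(G − π)
-- says 𝓜⁺_e ⊆ 𝓜⁺_π, which minimality of π upgrades to equality, while e ∈ b⁺(G − π) says that
-- every perfect matching contains e or π. In the latter case suppose the left end c of e is not on
-- an isolated edge. Then c has degree ≥ 3, so two further edges a, b at c; a matching containing a
-- misses e, hence contains π, so 𝓜⁺_a ⊆ 𝓜⁺_π and by minimality every perfect matching containing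
-- π contains a, and likewise b. This is absurd once some perfect matching N contains π. If the
-- given matching M₀ misses π it contains e, and strong connectivity of D(G, M₀) yields an
-- M₀-alternating cycle through e; flipping it (one pair of edges at a time along the walk,
-- short-cutting whenever the walk revisits a vertex) gives a perfect matching avoiding e, hence
-- containing π. So c lies on an isolated edge, which must be e itself.
module Submission where

open import Defs
open import Data.Nat using (ℕ; suc; _≤_; s≤s)
open import Data.Nat.Properties using (≤-refl; ≤-trans; n≤1+n; m≤n⇒m≤1+n)
open import Data.Fin using (Fin; zero; suc; punchIn; punchOut; _≟_)
open import Data.Fin.Properties using (punchIn-injective; punchInᵢ≢i; punchIn-punchOut; punchOut-punchIn)
open import Data.Fin.Subset using (Subset; _∈_; _∉_; _∪_; _-_; ⁅_⁆; outside)
open import Data.Fin.Subset.Properties using (_∈?_; x∈p∪q⁺; x∈p∪q⁻; x∈⁅x⁆; x∈⁅y⁆⇒x≡y; p─q⊆p; x∈p∧x≢y⇒x∈p-y)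
open import Data.Vec using (Vec; _∷_; there; lookup; removeAt; insertAt)
open import Data.Vec.Properties using ([]=⇒lookup; lookup⇒[]=; removeAt-punchOut; insertAt-lookup; insertAt-punchIn)
open import Data.Sum using (_⊎_; inj₁; inj₂)
import Data.Sum as Sum
open import Data.Sum.Properties using (≡-dec; inj₁-injective)
open import Data.Product using (∃; ∃₂; _×_; _,_; proj₁; proj₂)
import Data.Product as Product
open import Data.Empty using (⊥; ⊥-elim)
open import Function using (_∘_)
open import Function.Bundles using (_⇔_; mk⇔; Equivalence)
open import Function.Construct.Composition using (_⇔-∘_)
open import Relation.Nullary using (¬_; Dec; yes; no; contradiction)
open import Relation.Nullary.Decidable using (_⊎-dec_; decidable-stable)
open import Relation.Binary.PropositionalEquality using (_≡_; _≢_; refl; sym; trans; cong; module ≡-Reasoning)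
open import Relation.Binary.Construct.Closure.ReflexiveTransitive using (Star; ε; _◅_; _◅◅_)

∈-cong-lookup : ∀ {m n} {P : Subset m} {Q : Subset n} {x y} →
                lookup P x ≡ lookup Q y → x ∈ P → y ∈ Q
∈-cong-lookup {Q = Q} eq x∈P = lookup⇒[]= _ Q (trans (sym eq) ([]=⇒lookup x∈P))

x∉p-x : ∀ {n} (P : Subset n) x → x ∉ P - x
x∉p-x (s ∷ P) zero    ()
x∉p-x (s ∷ P) (suc x) (there x∈) = x∉p-x P x x∈

x∈p-y⁻ : ∀ {n} {P : Subset n} {x y} → x ∈ P - y → x ∈ P × x ≢ y
x∈p-y⁻ {P = P} {y = y} x∈ = p─q⊆p P ⁅ y ⁆ x∈ , λ { refl → x∉p-x P y x∈ }

x∈p∪⁅y⁆⁻ : ∀ {n} {P : Subset n} {x y} → x ∈ P ∪ ⁅ y ⁆ → x ∈ P ⊎ x ≡ y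
x∈p∪⁅y⁆⁻ {P = P} {y = y} = Sum.map₂ (x∈⁅y⁆⇒x≡y y) ∘ x∈p∪q⁻ P ⁅ y ⁆

lookup-removeAt : ∀ {A : Set} {n} (xs : Vec A (suc n)) i j →
                  lookup (removeAt xs i) j ≡ lookup xs (punchIn i j)
lookup-removeAt xs i j = begin
  lookup (removeAt xs i) j                                  ≡⟨ cong (lookup (removeAt xs i)) (punchOut-punchIn i) ⟨
  lookup (removeAt xs i) (punchOut (punchInᵢ≢i i j ∘ sym))  ≡⟨ removeAt-punchOut xs (punchInᵢ≢i i j ∘ sym) ⟩
  lookup xs (punchIn i j)                                   ∎
  where open ≡-Reasoning

∈-removeAt⁺ : ∀ {n} {P : Subset (suc n)} {i j} → punchIn i j ∈ P → j ∈ removeAt P i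
∈-removeAt⁺ {P = P} {i} {j} = ∈-cong-lookup (sym (lookup-removeAt P i j))

∈-removeAt⁻ : ∀ {n} {P : Subset (suc n)} {i j} → j ∈ removeAt P i → punchIn i j ∈ P
∈-removeAt⁻ {P = P} {i} {j} = ∈-cong-lookup (lookup-removeAt P i j)

∈-insertAt⁺ : ∀ {n} {P : Subset n} {i j s} → j ∈ P → punchIn i j ∈ insertAt P i s
∈-insertAt⁺ {P = P} {i} {j} {s} = ∈-cong-lookup (sym (insertAt-punchIn P i s j))

∈-insertAt⁻ : ∀ {n} {P : Subset n} {i j s} → punchIn i j ∈ insertAt P i s → j ∈ P
∈-insertAt⁻ {P = P} {i} {j} {s} = ∈-cong-lookup (insertAt-punchIn P i s j)

i∉insertAt-outside : ∀ {n} (P : Subset n) i → i ∉ insertAt P i outside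
i∉insertAt-outside P i i∈ with trans (sym (insertAt-lookup P i outside)) ([]=⇒lookup i∈)
... | ()

punchIn-surjective : ∀ {n} (i : Fin (suc n)) {j} → i ≢ j → ∃ λ k → punchIn i k ≡ j
punchIn-surjective i i≢j = punchOut i≢j , punchIn-punchOut i≢j

length : ∀ {V : Set} {R : V → V → Set} {a b} → Star R a b → ℕ
length ε       = 0
length (_ ◅ W) = suc (length W)

module _ {V : Set} {R S : V → V → Set} (z : V) (_≟z : ∀ x → Dec (x ≡ z))
         (carry : ∀ {x y} → x ≢ z → y ≢ z → R x y → S x y) where

  carry-or-suffix : ∀ {a b} → a ≢ z → (W : Star R a b) →
                    (∃ λ (W′ : Star S a b) → length W′ ≤ length W)
                    ⊎ (∃ λ (W′ : Star R z b) → length W′ ≤ length W)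
  carry-or-suffix a≢z ε = inj₁ (ε , ≤-refl)
  carry-or-suffix a≢z (_◅_ {j = y} r W) with y ≟z
  ... | yes refl = inj₂ (W , n≤1+n _)
  ... | no y≢z with carry-or-suffix y≢z W
  ...   | inj₁ (W′ , le) = inj₁ (carry a≢z y≢z r ◅ W′ , s≤s le)
  ...   | inj₂ (W′ , le) = inj₂ (W′ , m≤n⇒m≤1+n le)

_≟ᵛ_ : ∀ {p q} (u v : Vertex p q) → Dec (u ≡ v)
_≟ᵛ_ = ≡-dec _≟_ _≟_

module _ {p q m} (G : BipGraph p q m) where

  incidentˡ : ∀ {e a} → Incident G e (inj₁ a) → left G e ≡ a
  incidentˡ (inj₁ refl) = refl
  incidentˡ (inj₂ ())

  pm-uniqueˡ : ∀ {M e f} → IsPM G M → e ∈ M → f ∈ M → left G e ≡ left G f → e ≡ f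
  pm-uniqueˡ {f = f} pm e∈M f∈M le≡lf =
    proj₂ (pm (inj₁ (left G f))) _ _ e∈M f∈M (inj₁ (cong inj₁ (sym le≡lf))) (inj₁ refl)

  incident? : ∀ e v → Dec (Incident G e v)
  incident? e v = (v ≟ᵛ inj₁ (left G e)) ⊎-dec (v ≟ᵛ inj₂ (right G e))

  Hole : Fin p → Fin q → Vertex p q → Set
  Hole u w v = v ≡ inj₁ u ⊎ v ≡ inj₂ w

  record IsNearPM (M : Subset m) (u : Fin p) (w : Fin q) : Set where
    field
      covers : ∀ v → ¬ Hole u w v → ∃ λ e → e ∈ M × Incident G e v
      misses : ∀ {e v} → e ∈ M → Incident G e v → ¬ Hole u w v
      unique : ∀ {e f v} → e ∈ M → f ∈ M → Incident G e v → Incident G f v → e ≡ f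

  join-holes : ∀ {M g} → IsNearPM M (left G g) (right G g) → IsPM G (M ∪ ⁅ g ⁆)
  join-holes {M} {g} N v = cover , at-most-one
    where
    open IsNearPM N
    cover : ∃ λ e → e ∈ M ∪ ⁅ g ⁆ × Incident G e v
    cover with incident? g v
    ... | yes g~v = g , x∈p∪q⁺ (inj₂ (x∈⁅x⁆ g)) , g~v
    ... | no  g≁v with covers v g≁v
    ...   | e , e∈M , e~v = e , x∈p∪q⁺ (inj₁ e∈M) , e~v
    at-most-one : ∀ e f → e ∈ M ∪ ⁅ g ⁆ → f ∈ M ∪ ⁅ g ⁆ → Incident G e v → Incident G f v → e ≡ f
    at-most-one e f e∈ f∈ e~v f~v with x∈p∪⁅y⁆⁻ e∈ | x∈p∪⁅y⁆⁻ f∈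
    ... | inj₁ e∈M | inj₁ f∈M = unique e∈M f∈M e~v f~v
    ... | inj₁ e∈M | inj₂ refl = ⊥-elim (misses e∈M e~v f~v)
    ... | inj₂ refl | inj₁ f∈M = ⊥-elim (misses f∈M f~v e~v)
    ... | inj₂ refl | inj₂ refl = refl

  shift-hole : ∀ {M u g h} → IsNearPM M u (right G g) → h ∈ M → left G g ≡ left G h → left G g ≢ u →
               IsNearPM ((M - h) ∪ ⁅ g ⁆) u (right G h)
  shift-hole {M} {u} {g} {h} N h∈M lg≡lh lg≢u = record
    { covers = covers′ ; misses = misses′ ; unique = unique′ }
    where
    open IsNearPM N
    M′ = (M - h) ∪ ⁅ g ⁆

    g∈M′ : g ∈ M′
    g∈M′ = x∈p∪q⁺ (inj₂ (x∈⁅x⁆ g))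

    kept : ∀ {e} → e ∈ M → e ≢ h → e ∈ M′
    kept e∈M e≢h = x∈p∪q⁺ (inj₁ (x∈p∧x≢y⇒x∈p-y e∈M e≢h))

    old-or-g : ∀ {e} → e ∈ M′ → (e ∈ M × e ≢ h) ⊎ e ≡ g
    old-or-g = Sum.map₁ x∈p-y⁻ ∘ x∈p∪⁅y⁆⁻

    apart : ∀ {f v} → f ∈ M → f ≢ h → Incident G g v → Incident G f v → ⊥
    apart f∈M f≢h (inj₁ refl) f~v = f≢h (unique f∈M h∈M f~v (inj₁ (cong inj₁ lg≡lh)))
    apart f∈M f≢h (inj₂ refl) f~v = misses f∈M f~v (inj₂ refl)

    not-h : ∀ {e v} → ¬ Hole u (right G h) v → ¬ Incident G g v → Incident G e v → e ≢ h
    not-h v∉ g≁v (inj₁ v≡lh) refl = g≁v (inj₁ (trans v≡lh (cong inj₁ (sym lg≡lh))))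
    not-h v∉ g≁v (inj₂ v≡rh) refl = v∉ (inj₂ v≡rh)

    covers′ : ∀ v → ¬ Hole u (right G h) v → ∃ λ e → e ∈ M′ × Incident G e v
    covers′ v v∉ with incident? g v
    ... | yes g~v = g , g∈M′ , g~v
    ... | no  g≁v with covers v (Sum.[ v∉ ∘ inj₁ , g≁v ∘ inj₂ ])
    ...   | e , e∈M , e~v = e , kept e∈M (not-h v∉ g≁v e~v) , e~v

    misses′ : ∀ {e v} → e ∈ M′ → Incident G e v → ¬ Hole u (right G h) v
    misses′ e∈ e~v v∈ with old-or-g e∈
    misses′ e∈ e~v (inj₁ v≡u)  | inj₁ (e∈M , _)   = misses e∈M e~v (inj₁ v≡u)
    misses′ e∈ e~v (inj₂ v≡rh) | inj₁ (e∈M , e≢h) = e≢h (unique e∈M h∈M e~v (inj₂ v≡rh))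
    misses′ e∈ (inj₁ refl) (inj₁ v≡u)  | inj₂ refl = lg≢u (inj₁-injective v≡u)
    misses′ e∈ (inj₂ refl) (inj₂ v≡rh) | inj₂ refl = misses h∈M (inj₂ refl) (inj₂ (sym v≡rh))

    unique′ : ∀ {e f v} → e ∈ M′ → f ∈ M′ → Incident G e v → Incident G f v → e ≡ f
    unique′ e∈ f∈ e~v f~v with old-or-g e∈ | old-or-g f∈
    ... | inj₁ (e∈M , _)   | inj₁ (f∈M , _)   = unique e∈M f∈M e~v f~v
    ... | inj₁ (e∈M , e≢h) | inj₂ refl        = ⊥-elim (apart e∈M e≢h f~v e~v)
    ... | inj₂ refl        | inj₁ (f∈M , f≢h) = ⊥-elim (apart f∈M f≢h e~v f~v)
    ... | inj₂ refl        | inj₂ refl        = refl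

  shift-hole-arc : ∀ {M g h x y} → left G g ≡ left G h → x ≢ inj₁ (left G g) → y ≢ inj₁ (left G g) →
                   Arc G M x y → Arc G ((M - h) ∪ ⁅ g ⁆) x y
  shift-hole-arc {h = h} lg≡lh x≢ y≢ (k , inj₁ (k∈M , refl , refl)) =
    k , inj₁ (x∈p∪q⁺ (inj₁ (x∈p∧x≢y⇒x∈p-y k∈M k≢h)) , refl , refl)
    where
    k≢h : k ≢ h
    k≢h refl = x≢ (cong inj₁ (sym lg≡lh))
  shift-hole-arc lg≡lh x≢ y≢ (k , inj₂ (k∉M , refl , refl)) =
    k , inj₂ (Sum.[ k∉M ∘ proj₁ ∘ x∈p-y⁻ , (λ { refl → y≢ refl }) ] ∘ x∈p∪⁅y⁆⁻ , refl , refl)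

  ¬arc-from-left-hole : ∀ {M u w y} → IsNearPM M u w → ¬ Arc G M (inj₁ u) y
  ¬arc-from-left-hole N (e , inj₁ (e∈M , u≡le , _)) = IsNearPM.misses N e∈M (inj₁ u≡le) (inj₁ refl)

  -- The walk leaves the right hole w along a non-matching edge g to a = left g. If a = u, adding g
  -- fills both holes. Otherwise the walk leaves a along its matching edge h, and swapping h for g
  -- moves the right hole to right h while changing only arcs at a; if the rest of the walk returns
  -- to a, dropping that loop gives a shorter walk instead.
  augment : ∀ {M u w} → IsNearPM M u w → Reach G M (inj₂ w) (inj₁ u) → HasPM G
  augment N W = go (length W) N W ≤-refl
    where
    go : ∀ n {M u w} → IsNearPM M u w → (W : Reach G M (inj₂ w) (inj₁ u)) → length W ≤ n → HasPM G
    go n {u = u} N ((g , inj₂ (_ , refl , refl)) ◅ W) _ with left G g ≟ u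
    go n N ((g , inj₂ (_ , refl , refl)) ◅ W) _ | yes refl = _ , join-holes N
    go n N ((g , inj₂ (_ , refl , refl)) ◅ ε) _ | no lg≢u = contradiction refl lg≢u
    go (suc n) N (g-arc@(g , inj₂ (_ , refl , refl)) ◅ (h , inj₁ (h∈M , lg , refl)) ◅ W) (s≤s le)
      | no lg≢u
      with carry-or-suffix (inj₁ (left G g)) (_≟ᵛ inj₁ (left G g))
                           (shift-hole-arc (inj₁-injective lg)) (λ ()) W
    ... | inj₁ (W′ , le′) =
      go n (shift-hole N h∈M (inj₁-injective lg) lg≢u) W′ (≤-trans le′ (≤-trans (n≤1+n _) le))
    ... | inj₂ (W′ , le′) = go n N (g-arc ◅ W′) (≤-trans (s≤s le′) le)

module _ {p q k} (G : BipGraph p q (suc k)) (x : Fin (suc k)) where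

  removeAt-unique : ∀ {M i j v} → IsPM G M → i ∈ removeAt M x → j ∈ removeAt M x →
                    Incident (delete G x) i v → Incident (delete G x) j v → i ≡ j
  removeAt-unique pm i∈ j∈ i~v j~v =
    punchIn-injective x _ _ (proj₂ (pm _) _ _ (∈-removeAt⁻ i∈) (∈-removeAt⁻ j∈) i~v j~v)

  removeAt-covers : ∀ {M e v} → e ∈ M → e ≢ x → Incident G e v →
                    ∃ λ j → j ∈ removeAt M x × Incident (delete G x) j v
  removeAt-covers e∈M e≢x e~v with punchIn-surjective x (e≢x ∘ sym)
  ... | j , refl = j , ∈-removeAt⁺ e∈M , e~v

  removeAt-isPM : ∀ {M} → IsPM G M → x ∉ M → IsPM (delete G x) (removeAt M x)
  removeAt-isPM {M} pm x∉M v = cover , λ _ _ → removeAt-unique pm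
    where
    cover : ∃ λ j → j ∈ removeAt M x × Incident (delete G x) j v
    cover with proj₁ (pm v)
    ... | e , e∈M , e~v = removeAt-covers e∈M (λ { refl → x∉M e∈M }) e~v

  removeAt-isNearPM : ∀ {M} → IsPM G M → x ∈ M →
                      IsNearPM (delete G x) (removeAt M x) (left G x) (right G x)
  removeAt-isNearPM pm x∈M = record
    { covers = λ v v∉ → let (e , e∈M , e~v) = proj₁ (pm v)
                        in removeAt-covers e∈M (λ { refl → v∉ e~v }) e~v
    ; misses = λ j∈ j~v x~v → punchInᵢ≢i x _ (proj₂ (pm _) _ _ (∈-removeAt⁻ j∈) x∈M j~v x~v)
    ; unique = removeAt-unique pm
    }

  insertAt-isPM : ∀ {M} → IsPM (delete G x) M → IsPM G (insertAt M x outside)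
  insertAt-isPM {M} pm v = cover , unique
    where
    cover : ∃ λ e → e ∈ insertAt M x outside × Incident G e v
    cover with proj₁ (pm v)
    ... | j , j∈M , j~v = punchIn x j , ∈-insertAt⁺ j∈M , j~v
    unique : ∀ e f → e ∈ insertAt M x outside → f ∈ insertAt M x outside →
             Incident G e v → Incident G f v → e ≡ f
    unique e f e∈ f∈ e~v f~v
      with punchIn-surjective x {e} (λ { refl → i∉insertAt-outside M x e∈ })
         | punchIn-surjective x {f} (λ { refl → i∉insertAt-outside M x f∈ })
    ... | i , refl | j , refl =
      cong (punchIn x) (proj₂ (pm v) i j (∈-insertAt⁻ e∈) (∈-insertAt⁻ f∈) e~v f~v)

  arc-delete : ∀ {M a b} → (r : Arc G M a b) → proj₁ r ≢ x → Arc (delete G x) (removeAt M x) a b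
  arc-delete (e , r) e≢x with punchIn-surjective x (e≢x ∘ sym)
  ... | j , refl = j , Sum.map (Product.map₁ ∈-removeAt⁺) (Product.map₁ (_∘ ∈-removeAt⁻)) r

  reach-delete : ∀ {M a b} → x ∈ M → Reach G M a b →
                 Reach (delete G x) (removeAt M x) a b
                 ⊎ Reach (delete G x) (removeAt M x) (inj₂ (right G x)) b
  reach-delete x∈M ε = inj₁ ε
  reach-delete x∈M (r ◅ W) with reach-delete x∈M W | proj₁ r ≟ x
  ... | inj₂ W′ | _       = inj₂ W′
  ... | inj₁ W′ | no e≢x  = inj₁ (arc-delete r e≢x ◅ W′)
  reach-delete x∈M ((_ , inj₁ (_ , _ , refl)) ◅ W) | inj₁ W′ | yes refl = inj₂ W′
  reach-delete x∈M ((_ , inj₂ (x∉M , _ , _)) ◅ W)  | inj₁ W′ | yes refl = contradiction x∈M x∉M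

-- M minus e has holes at the ends of e in G − e; the walk after its last use of e, closed by f,
-- runs from one hole to the other.
alternating-cycle⇒avoiding-pm : ∀ {p q k} {G : BipGraph p q (suc k)} {M e f} → IsPM G M → e ∈ M →
  left G f ≡ left G e → f ≢ e → Reach G M (inj₁ (left G e)) (inj₂ (right G f)) →
  ∃ λ N → IsPM G N × e ∉ N
alternating-cycle⇒avoiding-pm {G = G} {M} {e} {f} pm e∈M lf≡le f≢e W with reach-delete G e e∈M W
... | inj₁ (r ◅ _) = ⊥-elim (¬arc-from-left-hole (delete G e) (removeAt-isNearPM G e pm e∈M) r)
... | inj₂ W′ =
  let (N , pmN) = augment (delete G e) (removeAt-isNearPM G e pm e∈M) (W′ ◅◅ f-arc ◅ ε)
  in insertAt N e outside , insertAt-isPM G e pmN , i∉insertAt-outside N e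
  where
  f∉M : f ∉ M
  f∉M f∈M = f≢e (pm-uniqueˡ G pm f∈M e∈M lf≡le)
  f-arc : Arc (delete G e) (removeAt M e) (inj₂ (right G f)) (inj₁ (left G e))
  f-arc = arc-delete G e (f , inj₂ (f∉M , refl , cong inj₁ (sym lf≡le))) f≢e

module _ {p q m} (G : BipGraph p q m) where

  MPlusMinimal-sub⇔eq : ∀ {π e} → MPlusMinimal G π → MPlusSub G e π ⇔ MPlusEq G π e
  MPlusMinimal-sub⇔eq {π} {e} minπ = mk⇔ (λ e⊆π → π⊆e e⊆π , e⊆π) proj₂
    where
    π⊆e : MPlusSub G e π → MPlusSub G π e
    π⊆e e⊆π M pm π∈M = decidable-stable (e ∈? M) (λ e∉M → minπ (e , e⊆π , M , pm , π∈M , e∉M))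

  two-other-edges : ∀ {v} → Deg≥3 G v → ∀ e →
    ∃₂ λ a b → a ≢ b × a ≢ e × b ≢ e × Incident G a v × Incident G b v
  two-other-edges (e₁ , e₂ , e₃ , i₁ , i₂ , i₃ , d₁₂ , d₁₃ , d₂₃) e with e₁ ≟ e | e₂ ≟ e
  ... | yes refl | _        = e₂ , e₃ , d₂₃ , d₁₂ ∘ sym , d₁₃ ∘ sym , i₂ , i₃
  ... | no e₁≢e  | yes refl = e₁ , e₃ , d₁₃ , e₁≢e , d₂₃ ∘ sym , i₁ , i₃
  ... | no e₁≢e  | no e₂≢e  = e₁ , e₂ , d₁₂ , e₁≢e , e₂≢e , i₁ , i₂

module _ {p q k} (G : BipGraph p q (suc k)) {π e} (forced : ∀ M → IsPM G M → π ∉ M → e ∈ M) where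

  forced⇒pm∋π : Trimmed G → ∀ {M₀ f} → IsPM G M₀ → left G f ≡ left G e → f ≢ e →
                ¬ OnIsolatedEdge G (inj₁ (left G e)) → ∃ λ N → IsPM G N × π ∈ N
  forced⇒pm∋π T {M₀} {f} pm₀ lf≡le f≢e off-isolated with π ∈? M₀
  ... | yes π∈M₀ = M₀ , pm₀ , π∈M₀
  ... | no π∉M₀ with alternating-cycle⇒avoiding-pm pm₀ (forced M₀ pm₀ π∉M₀) lf≡le f≢e cycle
    where
    cycle = Trimmed.stronglyConnected T M₀ pm₀ _ _ off-isolated
              ((f , inj₁ (cong inj₁ (sym lf≡le)) , inj₂ refl , λ ()) ◅ ε)
  ...   | N , pmN , e∉N = N , pmN , decidable-stable (π ∈? N) (λ π∉N → e∉N (forced N pmN π∉N))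

  forced⇒sibling∈pm∋π : MPlusMinimal G π → ∀ {N g} → IsPM G N → π ∈ N →
                        left G g ≡ left G e → g ≢ e → g ∈ N
  forced⇒sibling∈pm∋π minπ {N} {g} pmN π∈N lg≡le g≢e =
    proj₁ (Equivalence.to (MPlusMinimal-sub⇔eq G minπ) g⊆π) N pmN π∈N
    where
    g⊆π : MPlusSub G g π
    g⊆π M pm g∈M = decidable-stable (π ∈? M) λ π∉M → g≢e (pm-uniqueˡ G pm g∈M (forced M pm π∉M) lg≡le)

  forced⇒isolated : Trimmed G → HasPM G → MPlusMinimal G π → IsolatedEdge G e
  forced⇒isolated T (M₀ , pm₀) minπ f v e~v f~v with f ≟ e
  ... | yes f≡e = f≡e
  ... | no  f≢e = ⊥-elim (left-e-on-isolated left-e-not-on-isolated)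
    where
    left-e-not-on-isolated : ¬ OnIsolatedEdge G (inj₁ (left G e))
    left-e-not-on-isolated (h , h-iso , h~c) with h-iso e _ h~c (inj₁ refl)
    ... | refl = f≢e (h-iso f v e~v f~v)
    left-e-on-isolated : ¬ ¬ OnIsolatedEdge G (inj₁ (left G e))
    left-e-on-isolated off-isolated
      with two-other-edges G (Trimmed.degree T _ off-isolated) e
    ... | a , b , a≢b , a≢e , b≢e , a~c , b~c
      with forced⇒pm∋π T pm₀ (incidentˡ G a~c) a≢e off-isolated
    ... | N , pmN , π∈N = a≢b (proj₂ (pmN _) a b
            (forced⇒sibling∈pm∋π minπ pmN π∈N (incidentˡ G a~c) a≢e)
            (forced⇒sibling∈pm∋π minπ pmN π∈N (incidentˡ G b~c) b≢e) a~c b~c)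

module _ {p q k} (G : BipGraph p q (suc k)) (π : Fin (suc k)) where

  InBMinus-delete⇔ : ∀ e → InBMinus (delete G π) e ⇔ MPlusSub G (punchIn π e) π
  InBMinus-delete⇔ e = mk⇔ to from
    where
    to : InBMinus (delete G π) e → MPlusSub G (punchIn π e) π
    to e∉ M pm e∈M = decidable-stable (π ∈? M) λ π∉M →
      e∉ (removeAt M π) (removeAt-isPM G π pm π∉M) (∈-removeAt⁺ e∈M)
    from : MPlusSub G (punchIn π e) π → InBMinus (delete G π) e
    from e⊆π M pm e∈M = i∉insertAt-outside M π (e⊆π _ (insertAt-isPM G π pm) (∈-insertAt⁺ e∈M))

  InBPlus-delete⇒forced : ∀ e → InBPlus (delete G π) e → ∀ M → IsPM G M → π ∉ M → punchIn π e ∈ M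
  InBPlus-delete⇒forced e e∈ M pm π∉M = ∈-removeAt⁻ (e∈ (removeAt M π) (removeAt-isPM G π pm π∉M))

lemma6 : ∀ {p q k : ℕ} (G : BipGraph p q (suc k)) (π : Fin (suc k)) →
    HasPM G → IsConnected G → Trimmed G → MPlusMinimal G π →
    (∀ (e : Fin k) → InBMinus (delete G π) e ⇔ MPlusEq G π (punchIn π e))
    × (∀ (e : Fin k) → InBPlus (delete G π) e → IsolatedEdge G (punchIn π e))
lemma6 G π hasPM _ T minπ =
  (λ e → MPlusMinimal-sub⇔eq G minπ ⇔-∘ InBMinus-delete⇔ G π e) ,
  (λ e e∈ → forced⇒isolated G (InBPlus-delete⇒forced G π e e∈) T hasPM minπ)
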